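{- Let $H$ be a modular hyperplane of a matroid $M$ and let $C^*=E(M)-H$ be the complementary cocircuit. Then $\operatorname{cl}(C^*)$ is a rotunda of $M$, and every other rotunda of $M$ is contained in $H$.
   Context: A flat $F$ of $M$ is modular if $r(F)+r(F')=r(F\cap F')+r(F\cup F')$ for every flat $F'$. A vertical cover of a matroid $N$ is a pair $(F,F')$ of flats of $N$, neither equal to $E(N)$, with $F\cup F'=E(N)$; a set $X\subseteq E(M)$ is round if $M|X$ has no vertical cover. A rotunda is a round flat not properly contained in any other round flat. -}

module Defs where

open import Data.Nat using (ℕ; _≤_; _+_)
open import Data.Fin using (Fin)
open import Data.Fin.Subset using (Subset; _∪_; _∩_; ∁; ∣_∣; ⁅_⁆; _⊆_; ⊤; _∈_)
open import Data.Product using (_×_; Σ)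
open import Relation.Binary.PropositionalEquality using (_≡_; _≢_)
open import Relation.Nullary using (¬_)
open import Relation.Nullary.Decidable using (⌊_⌋)
open import Data.Nat using (_≟_)
open import Data.Vec using (tabulate)

record Matroid (n : ℕ) : Set where
  field
    r          : Subset n → ℕ
    r-bounded  : ∀ X → r X ≤ ∣ X ∣
    r-mono     : ∀ X Y → X ⊆ Y → r X ≤ r Y
    r-submod   : ∀ X Y → r (X ∪ Y) + r (X ∩ Y) ≤ r X + r Y

module _ {n : ℕ} (M : Matroid n) where
  open Matroid M

  cl : Subset n → Subset n
  cl X = tabulate (λ e → ⌊ r (X ∪ ⁅ e ⁆) ≟ r X ⌋)

  -- F is a flat of the restriction M|X (rank of M|X is r restricted to subsets of X)
  FlatIn : Subset n → Subset n → Set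
  FlatIn X F = F ⊆ X × (∀ e → e ∈ X → r (F ∪ ⁅ e ⁆) ≡ r F → e ∈ F)

  Flat : Subset n → Set
  Flat F = FlatIn ⊤ F

  Hyperplane : Subset n → Set
  Hyperplane H = Flat H × (r H + 1 ≡ r ⊤)

  Modular : Subset n → Set
  Modular F = Flat F × (∀ F' → Flat F' → r F + r F' ≡ r (F ∩ F') + r (F ∪ F'))

  VerticalCoverIn : Subset n → Subset n → Subset n → Set
  VerticalCoverIn X F F' = FlatIn X F × FlatIn X F' × F ≢ X × F' ≢ X × (F ∪ F') ≡ X

  Round : Subset n → Set
  Round X = ¬ (Σ (Subset n) λ F → Σ (Subset n) λ F' → VerticalCoverIn X F F')

  Rotunda : Subset n → Set
  Rotunda R = Round R × Flat R × (∀ F → Round F → Flat F → R ⊆ F → R ≡ F)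

-- Every element outside the hyperplane H lies in K = cl(E − H), so a round flat
-- meeting E − H cannot be split by the flats H and K and lies inside K; this gives
-- maximality of K and the second claim. K itself is round: a vertical cover (F, F')
-- of M|K would give c ∈ F' − F and c' ∈ F − F' outside H, spanning a line L. By
-- modularity r(H ∩ L) = r(L) − 1 = 1, so H ∩ L contains a non-loop p. Whichever of
-- F, F' contains p also contains one of c, c' outside H, hence all of L, hence both.
module Submission where

open import Defs
open import Data.Nat using (ℕ; suc; _≤_; _<_; _+_; s≤s; s≤s⁻¹)
open import Data.Nat.Properties
  using (≤-trans; ≤-reflexive; ≤-antisym; n≤0⇒n≡0; ≤∧≢⇒<; <-irrefl;
         +-mono-≤; +-monoˡ-≤; +-monoʳ-≤; m≤m+n; +-cancelˡ-≡; +-cancelˡ-≤; +-cancelʳ-≤;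
         +-suc; +-comm; module ≤-Reasoning)
open import Data.Fin using (Fin)
open import Data.Fin.Properties using (any?) renaming (_≟_ to _≟ᶠ_)
open import Data.Fin.Subset
open import Data.Fin.Subset.Properties
  using (_∈?_; ∈⊤; ⊆⊤; ⊥⊆; ∣⊥∣≡0; ∣⁅x⁆∣≡1; x∈⁅x⁆; x∈⁅y⁆⇒x≡y; ⊆-refl; ⊆-antisym;
         p⊆p∪q; q⊆p∪q; x∈p∪q⁻; x∈p∩q⁺; x∈p∩q⁻; p∩q⊆p; p∩q⊆q; ∪-identityˡ;
         nonempty?; p─q⊆p; x∈p⇒p-x⊂p; x∈p∧x≢y⇒x∈p-y; x∈∁p⇒x∉p; x∉p⇒x∈∁p)
open import Data.Fin.Subset.Induction using (Acc; acc; ⊂-wellFounded)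
open import Data.Product using (_×_; _,_; proj₁; proj₂; ∃)
open import Data.Sum using (_⊎_; inj₁; inj₂; [_,_]′)
open import Data.Bool.Properties using (T-≡)
open import Data.Vec.Properties using (lookup∘tabulate; []=⇒lookup; lookup⇒[]=)
open import Function using (_∘_; id)
open import Function.Bundles using (Equivalence)
open import Relation.Binary.PropositionalEquality
open import Relation.Nullary using (¬_; yes; no; contradiction)
open import Relation.Nullary.Decidable using (_×-dec_; ¬?; fromWitness; toWitness; decidable-stable)

module _ {n : ℕ} where

  ∪-⊆ : {p q s : Subset n} → p ⊆ s → q ⊆ s → p ∪ q ⊆ s
  ∪-⊆ {p} {q} p⊆s q⊆s x∈p∪q = [ p⊆s , q⊆s ]′ (x∈p∪q⁻ p q x∈p∪q)

  ⁅⁆-⊆ : {x : Fin n} {p : Subset n} → x ∈ p → ⁅ x ⁆ ⊆ p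
  ⁅⁆-⊆ {x} {p} x∈p y∈⁅x⁆ = subst (_∈ p) (sym (x∈⁅y⁆⇒x≡y x y∈⁅x⁆)) x∈p

  ⊆⊎∃∉ : (p q : Subset n) → p ⊆ q ⊎ ∃ λ x → x ∈ p × x ∉ q
  ⊆⊎∃∉ p q with any? (λ x → (x ∈? p) ×-dec ¬? (x ∈? q))
  ... | yes witness = inj₂ witness
  ... | no ∄ = inj₁ λ {x} x∈p → decidable-stable (x ∈? q) (λ x∉q → ∄ (x , x∈p , x∉q))

module Properties {n : ℕ} (M : Matroid n) where
  open Matroid M

  r-mono′ : {X Y : Subset n} → X ⊆ Y → r X ≤ r Y
  r-mono′ {X} {Y} = r-mono X Y

  r-submod-⊆ : (A B : Subset n) {U I : Subset n} →
               U ⊆ A ∪ B → I ⊆ A ∩ B → r U + r I ≤ r A + r B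
  r-submod-⊆ A B U⊆ I⊆ = ≤-trans (+-mono-≤ (r-mono′ U⊆) (r-mono′ I⊆)) (r-submod A B)

  r-⊥ : r ⊥ ≡ 0
  r-⊥ = n≤0⇒n≡0 (≤-trans (r-bounded ⊥) (≤-reflexive (∣⊥∣≡0 n)))

  r-⁅⁆≤1 : (e : Fin n) → r ⁅ e ⁆ ≤ 1
  r-⁅⁆≤1 e = ≤-trans (r-bounded ⁅ e ⁆) (≤-reflexive (∣⁅x⁆∣≡1 e))

  r-∪-⁅⁆≤ : (X : Subset n) (e : Fin n) → r (X ∪ ⁅ e ⁆) ≤ suc (r X)
  r-∪-⁅⁆≤ X e = begin
    r (X ∪ ⁅ e ⁆)                    ≤⟨ m≤m+n _ _ ⟩
    r (X ∪ ⁅ e ⁆) + r (X ∩ ⁅ e ⁆)    ≤⟨ r-submod X ⁅ e ⁆ ⟩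
    r X + r ⁅ e ⁆                    ≤⟨ +-monoʳ-≤ (r X) (r-⁅⁆≤1 e) ⟩
    r X + 1                          ≡⟨ +-comm (r X) 1 ⟩
    suc (r X)                        ∎
    where open ≤-Reasoning

  r-<-∪⁅⁆ : {G Y : Subset n} {e : Fin n} → Flat M G → Y ⊆ G → e ∉ G → r Y < r (Y ∪ ⁅ e ⁆)
  r-<-∪⁅⁆ {G} {Y} {e} flat-G Y⊆G e∉G = +-cancelˡ-≤ (r G) _ _ (begin
    r G + suc (r Y)              ≡⟨ +-suc (r G) (r Y) ⟩
    suc (r G) + r Y              ≤⟨ +-monoˡ-≤ (r Y) rG<rG+e ⟩
    r (G ∪ ⁅ e ⁆) + r Y          ≤⟨ r-submod-⊆ G (Y ∪ ⁅ e ⁆)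
                                      (∪-⊆ (p⊆p∪q _) (q⊆p∪q G _ ∘ q⊆p∪q Y ⁅ e ⁆))
                                      (λ y∈Y → x∈p∩q⁺ (Y⊆G y∈Y , p⊆p∪q ⁅ e ⁆ y∈Y)) ⟩
    r G + r (Y ∪ ⁅ e ⁆)          ∎)
    where
      open ≤-Reasoning
      rG<rG+e : r G < r (G ∪ ⁅ e ⁆)
      rG<rG+e = ≤∧≢⇒< (r-mono′ (p⊆p∪q ⁅ e ⁆)) (λ eq → e∉G (proj₂ flat-G e ∈⊤ (sym eq)))

  ∉flat⇒nonloop : {G : Subset n} {e : Fin n} → Flat M G → e ∉ G → 0 < r ⁅ e ⁆
  ∉flat⇒nonloop {e = e} flat-G e∉G =
    subst₂ _<_ r-⊥ (cong r (∪-identityˡ ⁅ e ⁆)) (r-<-∪⁅⁆ flat-G ⊥⊆ e∉G)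

  r-pair≤2 : (a b : Fin n) → r (⁅ a ⁆ ∪ ⁅ b ⁆) ≤ 2
  r-pair≤2 a b = ≤-trans (r-∪-⁅⁆≤ ⁅ a ⁆ b) (s≤s (r-⁅⁆≤1 a))

  r-pair≥2 : {G : Subset n} {a b : Fin n} →
             Flat M G → 0 < r ⁅ a ⁆ → a ∈ G → b ∉ G → 2 ≤ r (⁅ a ⁆ ∪ ⁅ b ⁆)
  r-pair≥2 flat-G a-nonloop a∈G b∉G = ≤-trans (s≤s a-nonloop) (r-<-∪⁅⁆ flat-G (⁅⁆-⊆ a∈G) b∉G)

  ∈cl⁺ : {X : Subset n} {e : Fin n} → r (X ∪ ⁅ e ⁆) ≡ r X → e ∈ cl M X
  ∈cl⁺ {X} {e} eq = lookup⇒[]= e (cl M X)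
    (trans (lookup∘tabulate _ e) (Equivalence.to T-≡ (fromWitness eq)))

  ∈cl⁻ : {X : Subset n} {e : Fin n} → e ∈ cl M X → r (X ∪ ⁅ e ⁆) ≡ r X
  ∈cl⁻ {X} {e} e∈cl = toWitness (Equivalence.from T-≡
    (trans (sym (lookup∘tabulate _ e)) ([]=⇒lookup e∈cl)))

  ⊆-cl : {X : Subset n} → X ⊆ cl M X
  ⊆-cl {X} {e} e∈X = ∈cl⁺ (cong r (⊆-antisym (∪-⊆ ⊆-refl (⁅⁆-⊆ e∈X)) (p⊆p∪q ⁅ e ⁆)))

  cl-minimal : {F X : Subset n} → Flat M F → X ⊆ F → cl M X ⊆ F
  cl-minimal {F} flat-F X⊆F {e} e∈clX with e ∈? F
  ... | yes e∈F = e∈F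
  ... | no e∉F = contradiction (r-<-∪⁅⁆ flat-F X⊆F e∉F) (<-irrefl (sym (∈cl⁻ e∈clX)))

  ⊆cl⇒r-∪≤ : {X : Subset n} (Y : Subset n) → Y ⊆ cl M X → r (X ∪ Y) ≤ r X
  ⊆cl⇒r-∪≤ {X} Y = go Y (⊂-wellFounded Y)
    where
      go : (Y : Subset n) → Acc _⊂_ Y → Y ⊆ cl M X → r (X ∪ Y) ≤ r X
      go Y (acc smaller) Y⊆cl with nonempty? Y
      ... | no Y-empty = r-mono′ (∪-⊆ ⊆-refl (λ y∈Y → contradiction (_ , y∈Y) Y-empty))
      ... | yes (y , y∈Y) = +-cancelʳ-≤ (r X) _ _ (begin
        r (X ∪ Y) + r X                      ≤⟨ r-submod-⊆ (X ∪ (Y - y)) (X ∪ ⁅ y ⁆) split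
                                                  (λ x∈X → x∈p∩q⁺ (p⊆p∪q _ x∈X , p⊆p∪q _ x∈X)) ⟩
        r (X ∪ (Y - y)) + r (X ∪ ⁅ y ⁆)      ≤⟨ +-mono-≤ (go (Y - y) (smaller (x∈p⇒p-x⊂p y∈Y))
                                                              (Y⊆cl ∘ p─q⊆p Y ⁅ y ⁆))
                                                            (≤-reflexive (∈cl⁻ (Y⊆cl y∈Y))) ⟩
        r X + r X                            ∎)
        where
          open ≤-Reasoning
          split : X ∪ Y ⊆ (X ∪ (Y - y)) ∪ (X ∪ ⁅ y ⁆)
          split {z} z∈X∪Y with x∈p∪q⁻ X Y z∈X∪Y
          ... | inj₁ z∈X = p⊆p∪q _ (p⊆p∪q _ z∈X)
          ... | inj₂ z∈Y with z ≟ᶠ y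
          ...   | yes refl = q⊆p∪q _ _ (q⊆p∪q X _ (x∈⁅x⁆ z))
          ...   | no z≢y = p⊆p∪q _ (q⊆p∪q X _ (x∈p∧x≢y⇒x∈p-y z∈Y z≢y))

  r-cl≤ : (X : Subset n) → r (cl M X) ≤ r X
  r-cl≤ X = ≤-trans (r-mono′ (q⊆p∪q X (cl M X))) (⊆cl⇒r-∪≤ (cl M X) ⊆-refl)

  cl-flat : (X : Subset n) → Flat M (cl M X)
  cl-flat X = ⊆⊤ , λ e _ eq → ∈cl⁺ (≤-antisym
    (begin
      r (X ∪ ⁅ e ⁆)         ≤⟨ r-mono′ (∪-⊆ (p⊆p∪q _ ∘ ⊆-cl) (q⊆p∪q _ _)) ⟩
      r (cl M X ∪ ⁅ e ⁆)    ≡⟨ eq ⟩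
      r (cl M X)            ≤⟨ r-cl≤ X ⟩
      r X                   ∎)
    (r-mono′ (p⊆p∪q ⁅ e ⁆)))
    where open ≤-Reasoning

  r≤⇒⊆cl : {X Y : Subset n} → Y ⊆ X → r X ≤ r Y → X ⊆ cl M Y
  r≤⇒⊆cl Y⊆X rX≤rY e∈X = ∈cl⁺ (≤-antisym
    (≤-trans (r-mono′ (∪-⊆ Y⊆X (⁅⁆-⊆ e∈X))) rX≤rY)
    (r-mono′ (p⊆p∪q _)))

  flatIn⇒flat : {K F : Subset n} → FlatIn M K F → Flat M K → Flat M F
  flatIn⇒flat (F⊆K , closed) flat-K =
    ⊆⊤ , λ e _ eq → closed e (cl-minimal flat-K F⊆K (∈cl⁺ eq)) eq

  ∩-flatIn : {G : Subset n} (X : Subset n) → Flat M G → FlatIn M X (X ∩ G)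
  ∩-flatIn {G} X flat-G =
    p∩q⊆p X G , λ e e∈X eq → x∈p∩q⁺ (e∈X , cl-minimal flat-G (p∩q⊆q X G) (∈cl⁺ eq))

  ∃nonloop : {Y : Subset n} → 0 < r Y → ∃ λ p → p ∈ Y × 0 < r ⁅ p ⁆
  ∃nonloop {Y} 0<rY with ⊆⊎∃∉ Y (cl M ⊥)
  ... | inj₂ (p , p∈Y , p∉cl⊥) = p , p∈Y , ∉flat⇒nonloop (cl-flat ⊥) p∉cl⊥
  ... | inj₁ Y⊆cl⊥ = contradiction
    (≤-trans 0<rY (≤-trans (r-mono′ (q⊆p∪q ⊥ Y)) (≤-trans (⊆cl⇒r-∪≤ Y Y⊆cl⊥) (≤-reflexive r-⊥))))
    λ ()

  round-⊆⊎⊆ : {X F G : Subset n} → Round M X → Flat M F → Flat M G →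
              X ⊆ F ∪ G → X ⊆ F ⊎ X ⊆ G
  round-⊆⊎⊆ {X} {F} {G} round flat-F flat-G X⊆F∪G with ⊆⊎∃∉ X F | ⊆⊎∃∉ X G
  ... | inj₁ X⊆F | _ = inj₁ X⊆F
  ... | inj₂ _ | inj₁ X⊆G = inj₂ X⊆G
  ... | inj₂ (a , a∈X , a∉F) | inj₂ (b , b∈X , b∉G) = contradiction
    (X ∩ F , X ∩ G , ∩-flatIn X flat-F , ∩-flatIn X flat-G ,
     misses F a∈X a∉F , misses G b∈X b∉G , ⊆-antisym (∪-⊆ (p∩q⊆p X F) (p∩q⊆p X G)) covered)
    round
    where
      misses : ∀ P {x} → x ∈ X → x ∉ P → X ∩ P ≢ X
      misses P {x} x∈X x∉P X∩P≡X = x∉P (proj₂ (x∈p∩q⁻ X P (subst (x ∈_) (sym X∩P≡X) x∈X)))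
      covered : X ⊆ (X ∩ F) ∪ (X ∩ G)
      covered x∈X = [ p⊆p∪q _ ∘ x∈p∩q⁺ ∘ (x∈X ,_) , q⊆p∪q _ _ ∘ x∈p∩q⁺ ∘ (x∈X ,_) ]′
                      (x∈p∪q⁻ F G (X⊆F∪G x∈X))

  round-⊈flat⇒⊆cl∁ : {H X : Subset n} {x : Fin n} → Flat M H → Round M X →
                     x ∈ X → x ∉ H → X ⊆ cl M (∁ H)
  round-⊈flat⇒⊆cl∁ {H} flat-H round x∈X x∉H
    with round-⊆⊎⊆ round flat-H (cl-flat (∁ H)) (λ {z} _ → H∪cl∁H z)
    where
      H∪cl∁H : ∀ z → z ∈ H ∪ cl M (∁ H)
      H∪cl∁H z with z ∈? H
      ... | yes z∈H = p⊆p∪q _ z∈H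
      ... | no z∉H = q⊆p∪q H _ (⊆-cl (x∉p⇒x∈∁p z∉H))
  ... | inj₁ X⊆H = contradiction (X⊆H x∈X) x∉H
  ... | inj₂ X⊆cl∁H = X⊆cl∁H

  properFlatIn-cl-misses : {X F : Subset n} → FlatIn M (cl M X) F → F ≢ cl M X →
                           ∃ λ c → c ∈ X × c ∉ F
  properFlatIn-cl-misses {X} {F} flatIn-F F≢clX with ⊆⊎∃∉ X F
  ... | inj₂ witness = witness
  ... | inj₁ X⊆F = contradiction
    (⊆-antisym (proj₁ flatIn-F) (cl-minimal (flatIn⇒flat flatIn-F (cl-flat X)) X⊆F)) F≢clX

module ModularHyperplane {n : ℕ} (M : Matroid n) {H : Subset n}
                         (hyperplane : Hyperplane M H) (modular : Modular M H) where
  open Matroid M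
  open Properties M

  flat-H : Flat M H
  flat-H = proj₁ hyperplane

  ∃∉H : ∃ λ c → c ∉ H
  ∃∉H with ⊆⊎∃∉ ⊤ H
  ... | inj₂ (c , _ , c∉H) = c , c∉H
  ... | inj₁ ⊤⊆H = contradiction (r-mono′ ⊤⊆H) λ r⊤≤rH →
    <-irrefl refl (≤-trans (≤-reflexive (trans (+-comm 1 (r H)) (proj₂ hyperplane))) r⊤≤rH)

  r-H∪flat : {G : Subset n} {e : Fin n} → Flat M G → e ∈ G → e ∉ H → r (H ∪ G) ≡ suc (r H)
  r-H∪flat flat-G e∈G e∉H = ≤-antisym
    (≤-trans (r-mono′ ⊆⊤) (≤-reflexive (trans (sym (proj₂ hyperplane)) (+-comm (r H) 1))))
    (≤-trans (r-<-∪⁅⁆ flat-H ⊆-refl e∉H) (r-mono′ (∪-⊆ (p⊆p∪q _) (q⊆p∪q H _ ∘ ⁅⁆-⊆ e∈G))))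

  r-H∩flat : {G : Subset n} {e : Fin n} → Flat M G → e ∈ G → e ∉ H → suc (r (H ∩ G)) ≡ r G
  r-H∩flat {G} flat-G e∈G e∉H = +-cancelˡ-≡ (r H) _ _ (begin
    r H + suc (r (H ∩ G))     ≡⟨ +-suc (r H) _ ⟩
    suc (r H + r (H ∩ G))     ≡⟨ cong suc (+-comm (r H) _) ⟩
    suc (r (H ∩ G) + r H)     ≡⟨ +-suc (r (H ∩ G)) (r H) ⟨
    r (H ∩ G) + suc (r H)     ≡⟨ cong (r (H ∩ G) +_) (r-H∪flat flat-G e∈G e∉H) ⟨
    r (H ∩ G) + r (H ∪ G)     ≡⟨ proj₂ modular G flat-G ⟨
    r H + r G                 ∎)
    where open ≡-Reasoning

  line-through-H : {L : Subset n} {e : Fin n} → Flat M L → r L ≡ 2 → e ∈ L → e ∉ H →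
                   ∃ λ p → p ∈ H × p ∈ L ×
                     (∀ {G a} → Flat M G → p ∈ G → a ∈ G → a ∉ H → a ∈ L → L ⊆ G)
  line-through-H {L} flat-L rL≡2 e∈L e∉H with ∃nonloop 0<r[H∩L]
    where
      0<r[H∩L] : 0 < r (H ∩ L)
      0<r[H∩L] = s≤s⁻¹ (≤-reflexive (trans (sym rL≡2) (sym (r-H∩flat flat-L e∈L e∉H))))
  ... | p , p∈H∩L , p-nonloop = p , p∈H , p∈L , L⊆
    where
      p∈H : p ∈ H
      p∈H = proj₁ (x∈p∩q⁻ H L p∈H∩L)
      p∈L : p ∈ L
      p∈L = proj₂ (x∈p∩q⁻ H L p∈H∩L)
      L⊆ : ∀ {G a} → Flat M G → p ∈ G → a ∈ G → a ∉ H → a ∈ L → L ⊆ G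
      L⊆ flat-G p∈G a∈G a∉H a∈L = cl-minimal flat-G (∪-⊆ (⁅⁆-⊆ p∈G) (⁅⁆-⊆ a∈G))
        ∘ r≤⇒⊆cl (∪-⊆ (⁅⁆-⊆ p∈L) (⁅⁆-⊆ a∈L))
                 (≤-trans (≤-reflexive rL≡2) (r-pair≥2 flat-H p-nonloop p∈H a∉H))

  flats-cannot-cover-line : {F F′ : Subset n} {c c′ : Fin n} → Flat M F → Flat M F′ →
                            c ∉ H → c′ ∉ H → c ∉ F → c ∈ F′ → c′ ∈ F → c′ ∉ F′ →
                            ¬ (cl M (⁅ c′ ⁆ ∪ ⁅ c ⁆) ⊆ F ∪ F′)
  flats-cannot-cover-line {F} {F′} {c} {c′} flat-F flat-F′ c∉H c′∉H c∉F c∈F′ c′∈F c′∉F′ L⊆F∪F′ =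
    let p , _ , p∈L , L⊆ = line-through-H (cl-flat (⁅ c′ ⁆ ∪ ⁅ c ⁆)) rL≡2 c∈L c∉H
    in [ (λ p∈F → c∉F (L⊆ flat-F p∈F c′∈F c′∉H c′∈L c∈L)) ,
         (λ p∈F′ → c′∉F′ (L⊆ flat-F′ p∈F′ c∈F′ c∉H c∈L c′∈L)) ]′
       (x∈p∪q⁻ F F′ (L⊆F∪F′ p∈L))
    where
      c∈L : c ∈ cl M (⁅ c′ ⁆ ∪ ⁅ c ⁆)
      c∈L = ⊆-cl (q⊆p∪q _ _ (x∈⁅x⁆ c))
      c′∈L : c′ ∈ cl M (⁅ c′ ⁆ ∪ ⁅ c ⁆)
      c′∈L = ⊆-cl (p⊆p∪q _ (x∈⁅x⁆ c′))
      rL≡2 : r (cl M (⁅ c′ ⁆ ∪ ⁅ c ⁆)) ≡ 2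
      rL≡2 = ≤-antisym (≤-trans (r-cl≤ _) (r-pair≤2 c′ c))
        (≤-trans (r-pair≥2 flat-F (∉flat⇒nonloop flat-F′ c′∉F′) c′∈F c∉F) (r-mono′ ⊆-cl))

  K : Subset n
  K = cl M (∁ H)

  ∉H⇒∈K : {x : Fin n} → x ∉ H → x ∈ K
  ∉H⇒∈K = ⊆-cl ∘ x∉p⇒x∈∁p

  K-round : Round M K
  K-round (F , F′ , flatIn-F , flatIn-F′ , F≢K , F′≢K , F∪F′≡K) =
    let c , c∈∁H , c∉F = properFlatIn-cl-misses flatIn-F F≢K
        c′ , c′∈∁H , c′∉F′ = properFlatIn-cl-misses flatIn-F′ F′≢K
        c∉H = x∈∁p⇒x∉p c∈∁H
        c′∉H = x∈∁p⇒x∉p c′∈∁H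
    in flats-cannot-cover-line flat-F flat-F′ c∉H c′∉H
         c∉F (∉F⇒∈F′ c∉H c∉F) (∉F′⇒∈F c′∉H c′∉F′) c′∉F′
         (K⊆F∪F′ ∘ cl-minimal (cl-flat (∁ H)) (∪-⊆ (⁅⁆-⊆ (∉H⇒∈K c′∉H)) (⁅⁆-⊆ (∉H⇒∈K c∉H))))
    where
      flat-F : Flat M F
      flat-F = flatIn⇒flat flatIn-F (cl-flat (∁ H))
      flat-F′ : Flat M F′
      flat-F′ = flatIn⇒flat flatIn-F′ (cl-flat (∁ H))
      K⊆F∪F′ : K ⊆ F ∪ F′
      K⊆F∪F′ {x} = subst (x ∈_) (sym F∪F′≡K)
      ∉F⇒∈F′ : ∀ {x} → x ∉ H → x ∉ F → x ∈ F′
      ∉F⇒∈F′ x∉H x∉F = [ (λ x∈F → contradiction x∈F x∉F) , id ]′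
                         (x∈p∪q⁻ F F′ (K⊆F∪F′ (∉H⇒∈K x∉H)))
      ∉F′⇒∈F : ∀ {x} → x ∉ H → x ∉ F′ → x ∈ F
      ∉F′⇒∈F x∉H x∉F′ = [ id , (λ x∈F′ → contradiction x∈F′ x∉F′) ]′
                          (x∈p∪q⁻ F F′ (K⊆F∪F′ (∉H⇒∈K x∉H)))

  K-rotunda : Rotunda M K
  K-rotunda = K-round , cl-flat (∁ H) , K-maximal
    where
      K-maximal : ∀ F → Round M F → Flat M F → K ⊆ F → K ≡ F
      K-maximal F round-F _ K⊆F = ⊆-antisym K⊆F
        (round-⊈flat⇒⊆cl∁ flat-H round-F (K⊆F (∉H⇒∈K (proj₂ ∃∉H))) (proj₂ ∃∉H))

  rotunda≢K⇒⊆H : ∀ R → Rotunda M R → R ≢ K → R ⊆ H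
  rotunda≢K⇒⊆H R (round-R , _ , R-maximal) R≢K {x} x∈R with x ∈? H
  ... | yes x∈H = x∈H
  ... | no x∉H = contradiction
    (R-maximal K K-round (cl-flat (∁ H)) (round-⊈flat⇒⊆cl∁ flat-H round-R x∈R x∉H)) R≢K

mainTheorem17 : {n : ℕ} (M : Matroid n) (H : Subset n) →
    Hyperplane M H → Modular M H →
    Rotunda M (cl M (∁ H)) ×
      (∀ R → Rotunda M R → R ≢ cl M (∁ H) → R ⊆ H)
mainTheorem17 M H hyperplane modular = K-rotunda , rotunda≢K⇒⊆H
  where open ModularHyperplane M hyperplane modular
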